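{- Let $n\ge 3$ be an integer and let $P(G(n))$ be the power graph of the gyrogroup $(G(n),\oplus)$ described in the context. Then $P(G(n))$ is not Hamiltonian.
   Context: Let $n\ge 3$ and $m=2^{n-1}$. Put $P(n)=\{0,1,\dots,m-1\}$, $H(n)=\{m,m+1,\dots,2^n-1\}$ and $G(n)=P(n)\cup H(n)$. Define a binary operation $\oplus$ on $G(n)$ by: $i\oplus j=t$ if $(i,j)\in P(n)\times P(n)$; $i\oplus j=t+m$ if $(i,j)\in P(n)\times H(n)$; $i\oplus j=s+m$ if $(i,j)\in H(n)\times P(n)$; $i\oplus j=k$ if $(i,j)\in H(n)\times H(n)$, where $t,s,k\in P(n)$ are determined by $t\equiv i+j$, $s\equiv i+(\tfrac m2-1)j$, $k\equiv(\tfrac m2+1)i+(\tfrac m2-1)j \pmod m$. Then $(G(n),\oplus)$ is a gyrogroup with identity $e=0$, and $P(n)$ is the cyclic group of integers modulo $m$. Powers are defined by $a^1=a$, $a^{k+1}=a\oplus a^k$. The power graph $P(G(n))$ is the simple undirected graph with vertex set $G(n)$ in which two distinct vertices $u,v$ are adjacent if and only if $u^k=v$ or $v^k=u$ for some positive integer $k$. A graph is Hamiltonian if it has a cycle through all its vertices. -}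

module Defs where

open import Data.Nat using (ℕ; zero; suc; _+_; _*_; _∸_; _^_; _<_; _≤_; _<ᵇ_; _/_; _%_; NonZero)
open import Data.Nat.Properties using (m^n≢0)
open import Data.Bool using (if_then_else_)
open import Data.Fin using (Fin; toℕ)
open import Data.Product using (Σ; _×_; ∃-syntax)
open import Data.Sum using (_⊎_)
open import Relation.Binary.PropositionalEquality using (_≡_; _≢_)
open import Relation.Nullary using (¬_)
open import Function.Definitions using (Injective)

half : ℕ → ℕ
half n = 2 ^ (n ∸ 1)

half-nz : (n : ℕ) → NonZero (half n)
half-nz n = m^n≢0 2 (n ∸ 1)

-- P(n) = {0,…,m-1}, H(n) = {m,…,2m-1}.  Residues mod m are taken of the raw
-- values i, j (legitimate since i ≡ i - m (mod m)).
gop : (n : ℕ) → ℕ → ℕ → ℕ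
gop n i j =
  if i <ᵇ m
  then (if j <ᵇ m
        then (i + j) % m
        else (i + j) % m + m)
  else (if j <ᵇ m
        then (i + (m / 2 ∸ 1) * j) % m + m
        else ((m / 2 + 1) * i + (m / 2 ∸ 1) * j) % m)
  where
  m = half n
  instance
    nz : NonZero m
    nz = half-nz n

-- powers: a^1 = a, a^(k+1) = a ⊕ a^k   (a^0 is never used; set to e = 0)
gpow : (n : ℕ) → ℕ → ℕ → ℕ
gpow n a zero = 0
gpow n a (suc zero) = a
gpow n a (suc (suc k)) = gop n a (gpow n a (suc k))

Vertex : ℕ → Set
Vertex n = Fin (2 ^ n)

Adj : (n : ℕ) → Vertex n → Vertex n → Set
Adj n u v = toℕ u ≢ toℕ v ×
            ((∃[ k ] (1 ≤ k × gpow n (toℕ u) k ≡ toℕ v)) ⊎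
             (∃[ k ] (1 ≤ k × gpow n (toℕ v) k ≡ toℕ u)))

IsHamiltonian : {N : ℕ} → (Fin N → Fin N → Set) → Set
IsHamiltonian {N} E =
  3 ≤ N ×
  Σ (Fin N → Fin N) λ c →
    Injective _≡_ _≡_ c ×
    (∀ (i j : Fin N) →
       (suc (toℕ i) ≡ toℕ j ⊎ (suc (toℕ i) ≡ N × toℕ j ≡ 0)) →
       E (c i) (c j))

-- The vertex m = 2^(n-1) is pendant in the power graph: the cyclic group P(n) is closed under
-- powers, and every a ∈ H(n) satisfies a ⊕ a = 0 (the coefficients m/2 + 1 and m/2 - 1 of the
-- H × H rule add up to m) and a ⊕ 0 = a, so the powers of a alternate a, 0, a, 0, ….  Hence
-- m is a power only of itself and its only proper power is 0.  A vertex of a Hamiltonian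
-- cycle on at least three vertices has two distinct neighbours, so no such cycle exists.
module Submission where

open import Defs
open import Data.Bool using (true; false; T)
open import Data.Bool.Properties using (T-≡)
open import Data.Fin using (Fin; zero; suc; toℕ; fromℕ; fromℕ<; inject₁; lower₁; punchOut)
open import Data.Fin.Properties
  using (any?; punchOut-injective; injective⇒≤; toℕ-fromℕ; toℕ-inject₁; toℕ-lower₁;
         toℕ-fromℕ<; toℕ-injective; toℕ<n)
  renaming (_≟_ to _≟ᶠ_)
open import Data.Nat using (ℕ; zero; suc; _+_; _*_; _∸_; _^_; _<_; _≤_; _<ᵇ_; _/_; _%_;
                            NonZero; s≤s)
open import Data.Nat.DivMod
  using (m%n<n; m*n%n≡0; m*n/n≡m; m<n⇒m%n≡m; m≤n⇒[n∸m]%m≡n%m)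
open import Data.Nat.Properties
  using (_≟_; <⇒<ᵇ; <ᵇ⇒<; ≤⇒≯; 1+n≰n; m^n≢0; m^n>0; *-comm; *-distribʳ-+; *-zeroʳ;
         +-identityʳ; +-assoc; m+[n∸m]≡n; m∸n+n≡m; m<m+n; m<n+o⇒m∸n<o; <⇒≢; _<?_; ≮⇒≥; ≤-refl)
open import Data.Product using (∃; _×_; _,_)
open import Data.Sum using (_⊎_; inj₁; inj₂)
import Data.Sum as Sum
open import Function.Base using (_∘_)
open import Function.Bundles using (Equivalence)
open import Function.Definitions using (Injective; StrictlySurjective)
open import Relation.Binary.PropositionalEquality
open import Relation.Nullary using (¬_; yes; no; contradiction)

injective⇒strictlySurjective : ∀ {N} {f : Fin N → Fin N} →
                               Injective _≡_ _≡_ f → StrictlySurjective _≡_ f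
injective⇒strictlySurjective {suc N} {f} f-inj v with any? (λ i → f i ≟ᶠ v)
... | yes hit = hit
... | no miss = contradiction (injective⇒≤ g-inj) 1+n≰n
  where
  v≢f : ∀ i → v ≢ f i
  v≢f i v≡fi = miss (i , sym v≡fi)
  g : Fin (suc N) → Fin N
  g i = punchOut (v≢f i)
  g-inj : Injective _≡_ _≡_ g
  g-inj eq = f-inj (punchOut-injective (v≢f _) (v≢f _) eq)

CycleStep : ∀ {N} → Fin N → Fin N → Set
CycleStep {N} i j = suc (toℕ i) ≡ toℕ j ⊎ (suc (toℕ i) ≡ N × toℕ j ≡ 0)

cycleSuc : ∀ {N} (i : Fin (suc N)) → ∃ (CycleStep i)
cycleSuc {N} i with N ≟ toℕ i
... | yes N≡i = zero , inj₂ (cong suc (sym N≡i) , refl)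
... | no N≢i  = suc (lower₁ i N≢i) , inj₁ (cong suc (sym (toℕ-lower₁ i N≢i)))

cyclePred : ∀ {N} (i : Fin (suc N)) → ∃ λ p → CycleStep p i
cyclePred {N} zero = fromℕ N , inj₂ (cong suc (toℕ-fromℕ N) , refl)
cyclePred (suc i)  = inject₁ i , inj₁ (cong suc (toℕ-inject₁ i))

cycleStep-asym : ∀ {N} → 3 ≤ N → {i j : Fin N} → CycleStep i j → ¬ CycleStep j i
cycleStep-asym 3≤N i→j j→i = asym i→j j→i 3≤N
  where
  asym : ∀ {N a b} → suc a ≡ b ⊎ (suc a ≡ N × b ≡ 0) → suc b ≡ a ⊎ (suc b ≡ N × a ≡ 0) → ¬ 3 ≤ N
  asym (inj₁ refl)          (inj₁ ())
  asym (inj₁ refl)          (inj₂ (refl , refl)) (s≤s (s≤s ()))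
  asym (inj₂ (refl , refl)) (inj₁ refl)          (s≤s (s≤s ()))
  asym (inj₂ (refl , refl)) (inj₂ (refl , refl)) (s≤s ())

pendant⇒¬IsHamiltonian : ∀ {N} {E : Fin N → Fin N → Set} (v w : Fin N) →
                         (∀ x → E x v → x ≡ w) → (∀ y → E v y → y ≡ w) → ¬ IsHamiltonian E
pendant⇒¬IsHamiltonian {zero}  v _ _ _ _ = contradiction v (λ ())
pendant⇒¬IsHamiltonian {suc N} {E} v w into out (3≤N , c , c-inj , edge)
  with i , ci≡v ← injective⇒strictlySurjective c-inj v
  with p , p→i ← cyclePred i
  with j , i→j ← cycleSuc i
  = cycleStep-asym 3≤N p→i (subst (CycleStep i) (c-inj (trans cj≡w (sym cp≡w))) i→j)
  where
  cp≡w : c p ≡ w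
  cp≡w = into (c p) (subst (E (c p)) ci≡v (edge p i p→i))
  cj≡w : c j ≡ w
  cj≡w = out (c j) (subst (λ x → E x (c j)) ci≡v (edge i j i→j))

<ᵇ-true : ∀ {a b} → a < b → (a <ᵇ b) ≡ true
<ᵇ-true a<b = Equivalence.to T-≡ (<⇒<ᵇ a<b)

<ᵇ-false : ∀ {a b} → b ≤ a → (a <ᵇ b) ≡ false
<ᵇ-false {a} {b} b≤a with a <ᵇ b in eq
... | false = refl
... | true  = contradiction (<ᵇ⇒< a b (subst T (sym eq) _)) (≤⇒≯ b≤a)

-- Holds for k = 0 too, since 1 / 2 = 0 and the truncated 0 ∸ 1 is 0.
[2^k/2+1]+[2^k/2∸1]≡2^k : ∀ k → (2 ^ k / 2 + 1) + (2 ^ k / 2 ∸ 1) ≡ 2 ^ k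
[2^k/2+1]+[2^k/2∸1]≡2^k zero    = refl
[2^k/2+1]+[2^k/2∸1]≡2^k (suc k) = begin
  (2 ^ suc k / 2 + 1) + (2 ^ suc k / 2 ∸ 1) ≡⟨ cong (λ h → (h + 1) + (h ∸ 1)) 2^[1+k]/2≡2^k ⟩
  (h + 1) + (h ∸ 1)                         ≡⟨ +-assoc h 1 (h ∸ 1) ⟩
  h + (1 + (h ∸ 1))                         ≡⟨ cong (h +_) (m+[n∸m]≡n (m^n>0 2 k)) ⟩
  h + h                                     ≡⟨ cong (h +_) (+-identityʳ h) ⟨
  2 ^ suc k                                 ∎
  where
  open ≡-Reasoning
  h : ℕ
  h = 2 ^ k
  2^[1+k]/2≡2^k : 2 ^ suc k / 2 ≡ h
  2^[1+k]/2≡2^k = trans (cong (_/ 2) (*-comm 2 h)) (m*n/n≡m h 2)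

module PendantVertex (k : ℕ) where
  private
    n : ℕ
    n = suc k

    m : ℕ
    m = half n

    instance
      m≢0 : NonZero m
      m≢0 = m^n≢0 2 k

  _⊕_ : ℕ → ℕ → ℕ
  _⊕_ = gop n

  ⊕-P-P : ∀ {a b} → a < m → b < m → a ⊕ b ≡ (a + b) % m
  ⊕-P-P a<m b<m rewrite <ᵇ-true a<m | <ᵇ-true b<m = refl

  ⊕-H-P : ∀ {a b} → m ≤ a → b < m → a ⊕ b ≡ (a + (m / 2 ∸ 1) * b) % m + m
  ⊕-H-P m≤a b<m rewrite <ᵇ-false m≤a | <ᵇ-true b<m = refl

  ⊕-H-H : ∀ {a b} → m ≤ a → m ≤ b → a ⊕ b ≡ ((m / 2 + 1) * a + (m / 2 ∸ 1) * b) % m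
  ⊕-H-H m≤a m≤b rewrite <ᵇ-false m≤a | <ᵇ-false m≤b = refl

  H-⊕-self : ∀ {a} → m ≤ a → a ⊕ a ≡ 0
  H-⊕-self {a} m≤a = begin
    a ⊕ a                                   ≡⟨ ⊕-H-H m≤a m≤a ⟩
    ((m / 2 + 1) * a + (m / 2 ∸ 1) * a) % m ≡⟨ cong (_% m) (*-distribʳ-+ a (m / 2 + 1) (m / 2 ∸ 1)) ⟨
    (((m / 2 + 1) + (m / 2 ∸ 1)) * a) % m   ≡⟨ cong (λ c → (c * a) % m) ([2^k/2+1]+[2^k/2∸1]≡2^k k) ⟩
    (m * a) % m                             ≡⟨ cong (_% m) (*-comm m a) ⟩
    (a * m) % m                             ≡⟨ m*n%n≡0 a m ⟩
    0                                       ∎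
    where open ≡-Reasoning

  H-⊕-identityʳ : ∀ {a} → m ≤ a → a < m + m → a ⊕ 0 ≡ a
  H-⊕-identityʳ {a} m≤a a<2m = begin
    a ⊕ 0                              ≡⟨ ⊕-H-P m≤a (m^n>0 2 k) ⟩
    (a + (m / 2 ∸ 1) * 0) % m + m      ≡⟨ cong (λ z → (a + z) % m + m) (*-zeroʳ (m / 2 ∸ 1)) ⟩
    (a + 0) % m + m                    ≡⟨ cong (λ z → z % m + m) (+-identityʳ a) ⟩
    a % m + m                          ≡⟨ cong (_+ m) (m≤n⇒[n∸m]%m≡n%m m≤a) ⟨
    (a ∸ m) % m + m                    ≡⟨ cong (_+ m) (m<n⇒m%n≡m (m<n+o⇒m∸n<o a m a<2m)) ⟩
    (a ∸ m) + m                        ≡⟨ m∸n+n≡m m≤a ⟩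
    a                                  ∎
    where open ≡-Reasoning

  P-pow-closed : ∀ {a} → a < m → ∀ j → gpow n a j < m
  P-pow-closed a<m zero          = m^n>0 2 k
  P-pow-closed a<m (suc zero)    = a<m
  P-pow-closed a<m (suc (suc j)) =
    subst (_< m) (sym (⊕-P-P a<m (P-pow-closed a<m (suc j)))) (m%n<n _ m)

  H-pow : ∀ {a} → m ≤ a → a < m + m → ∀ j → gpow n a j ≡ a ⊎ gpow n a j ≡ 0
  H-pow m≤a a<2m zero          = inj₂ refl
  H-pow m≤a a<2m (suc zero)    = inj₁ refl
  H-pow {a} m≤a a<2m (suc (suc j)) with H-pow m≤a a<2m (suc j)
  ... | inj₁ aʲ≡a = inj₂ (trans (cong (a ⊕_) aʲ≡a) (H-⊕-self m≤a))
  ... | inj₂ aʲ≡0 = inj₁ (trans (cong (a ⊕_) aʲ≡0) (H-⊕-identityʳ m≤a a<2m))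

  pow≡m⇒≡m : ∀ {a} → a < m + m → ∀ j → gpow n a j ≡ m → a ≡ m
  pow≡m⇒≡m {a} a<2m j aʲ≡m with a <? m
  ... | yes a<m = contradiction aʲ≡m (<⇒≢ (P-pow-closed a<m j))
  ... | no a≮m with H-pow (≮⇒≥ a≮m) a<2m j
  ...   | inj₁ aʲ≡a = trans (sym aʲ≡a) aʲ≡m
  ...   | inj₂ aʲ≡0 = contradiction (trans (sym aʲ≡0) aʲ≡m) (<⇒≢ (m^n>0 2 k))

  neighbour-of-m : ∀ {x} → x < m + m → x ≢ m →
                   (∃ λ j → gpow n m j ≡ x) ⊎ (∃ λ j → gpow n x j ≡ m) → x ≡ 0
  neighbour-of-m x<2m x≢m (inj₁ (j , mʲ≡x)) with H-pow ≤-refl (m<m+n m (m^n>0 2 k)) j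
  ... | inj₁ mʲ≡m = contradiction (trans (sym mʲ≡x) mʲ≡m) x≢m
  ... | inj₂ mʲ≡0 = trans (sym mʲ≡x) mʲ≡0
  neighbour-of-m x<2m x≢m (inj₂ (j , xʲ≡m)) = contradiction (pow≡m⇒≡m x<2m j xʲ≡m) x≢m

  2^n≡m+m : 2 ^ n ≡ m + m
  2^n≡m+m = cong (m +_) (+-identityʳ m)

  toℕ<m+m : (x : Vertex n) → toℕ x < m + m
  toℕ<m+m x = subst (toℕ x <_) 2^n≡m+m (toℕ<n x)

  Adj-sym : ∀ {u v} → Adj n u v → Adj n v u
  Adj-sym (u≢v , power) = u≢v ∘ sym , Sum.swap power

  Adj-from-m : ∀ {v x} → toℕ v ≡ m → Adj n v x → toℕ x ≡ 0
  Adj-from-m {v} {x} v≡m (v≢x , power) =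
    neighbour-of-m (toℕ<m+m x) (λ x≡m → v≢x (trans v≡m (sym x≡m)))
      (Sum.map (λ (j , _ , vʲ≡x) → j , subst (λ a → gpow n a j ≡ toℕ x) v≡m vʲ≡x)
               (λ (j , _ , xʲ≡v) → j , trans xʲ≡v v≡m)
               power)

  vertex-m vertex-0 : Vertex n
  vertex-m = fromℕ< (subst (m <_) (sym 2^n≡m+m) (m<m+n m (m^n>0 2 k)))
  vertex-0 = fromℕ< (m^n>0 2 n)

  ¬IsHamiltonian : ¬ IsHamiltonian (Adj n)
  ¬IsHamiltonian = pendant⇒¬IsHamiltonian {E = Adj n} vertex-m vertex-0
                     (λ x adj → only-0 (Adj-sym adj)) (λ y adj → only-0 adj)
    where
    only-0 : ∀ {x} → Adj n vertex-m x → x ≡ vertex-0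
    only-0 adj = toℕ-injective (trans (Adj-from-m (toℕ-fromℕ< _) adj) (sym (toℕ-fromℕ< _)))

mainTheorem2 : (n : ℕ) → 3 ≤ n → ¬ IsHamiltonian (Adj n)
mainTheorem2 (suc k) _ = PendantVertex.¬IsHamiltonian k
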